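{- Every isosceles Heron triangle having two sides whose lengths are perfect squares is obtained, by scaling by a suitable positive rational factor, from the triangle with side lengths $\left(1,\,1,\,\dfrac{4k}{k^2+1}\right)$ for some positive rational number $k\neq 1$.
   Context: A Heron triangle is a (non-degenerate) triangle whose three side lengths and whose area are all positive integers. -}

module Defs where

open import Data.Nat as ℕ using (ℕ; _+_; _*_; _∸_; _<_)
open import Data.Integer using (+_; -[1+_])
open import Data.Rational as ℚ using (ℚ; mkℚ; NonNegative; NonZero; _÷_)
open import Data.Rational.Properties as ℚP
open import Data.Product using (Σ; ∃; _×_; _,_)
open import Data.Sum using (_⊎_)
open import Relation.Binary.PropositionalEquality using (_≡_)

IsSquare : ℕ → Set
IsSquare n = ∃ λ m → n ≡ m * m

-- Heron triangle with integer side lengths a b c: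
-- positive sides, non-degenerate (strict triangle inequalities), and
-- positive integer area A, where by Heron's formula
-- 16 A² = (a+b+c)(-a+b+c)(a-b+c)(a+b-c).
IsHeron : ℕ → ℕ → ℕ → Set
IsHeron a b c =
  0 < a × 0 < b × 0 < c ×
  a < b + c × b < a + c × c < a + b ×
  (Σ ℕ λ A → 0 < A ×
     16 * (A * A) ≡ (a + b + c) * (b + c ∸ a) * (a + c ∸ b) * (a + b ∸ c))

IsIsosceles : ℕ → ℕ → ℕ → Set
IsIsosceles a b c = a ≡ b ⊎ b ≡ c ⊎ a ≡ c

TwoSquareSides : ℕ → ℕ → ℕ → Set
TwoSquareSides a b c =
  (IsSquare a × IsSquare b) ⊎ (IsSquare b × IsSquare c) ⊎ (IsSquare a × IsSquare c)

sq-nonNeg : ∀ k → NonNegative (k ℚ.* k)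
sq-nonNeg k@(mkℚ (+ _) _ _) = nonNeg*nonNeg⇒nonNeg k k
sq-nonNeg k@(mkℚ -[1+ _ ] _ _) = pos⇒nonNeg (k ℚ.* k) {{neg*neg⇒pos k k}}

sq+1-nonZero : ∀ k → NonZero (k ℚ.* k ℚ.+ ℚ.1ℚ)
sq+1-nonZero k = pos⇒nonZero (k ℚ.* k ℚ.+ ℚ.1ℚ) {{nonNeg+pos⇒pos (k ℚ.* k) {{sq-nonNeg k}} ℚ.1ℚ}}

baseSide : ℚ → ℚ
baseSide k = ((+ 4 ℚ./ 1) ℚ.* k) ÷ (k ℚ.* k ℚ.+ ℚ.1ℚ)
  where instance _ = sq+1-nonZero k

toℚ : ℕ → ℚ
toℚ n = + n ℚ./ 1

{-# OPTIONS --safe #-}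
-- An isosceles Heron triangle (x, x, c) with area A satisfies 16 A² + c⁴ = 4 x² c² by
-- Heron's formula. Its shape is that of (1, 1, 4k/(k² + 1)) exactly when k solves
-- c k² − 4 x k + c = 0, whose discriminant 16 x² − 4 c² = (8A/c)² is a rational square.
-- As the roots multiply to 1, one of them is k = c² / D with D = 2 x c + 4 A, and the
-- quadratic becomes the integer identity c⁴ + D² = 4 x c D. The root k = 1 would give
-- the degenerate triangle (1, 1, 2).
module Submission where

open import Defs
open import Data.Nat using (ℕ)
open import Data.Rational using (ℚ; 0ℚ; 1ℚ; _<_; _*_)
open import Data.List using (_∷_; [])
open import Data.List.Relation.Binary.Permutation.Propositional using (_↭_)
open import Data.Product using (Σ; _×_)
open import Relation.Binary.PropositionalEquality using (_≢_)

open import Data.Nat as ℕ using (_+_; _∸_)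
import Data.Nat.Properties as ℕP
open import Data.Nat.Tactic.RingSolver using (solve)
import Data.Nat.Coprimality as Coprime
open import Data.Integer as ℤ using (+_)
import Data.Integer.Properties as ℤP
open import Data.Rational as ℚ using (mkℚ; toℚᵘ; 1/_; Positive; NonZero)
open import Data.Rational.Properties
open import Data.Rational.Unnormalised as ℚᵘ using (ℚᵘ; mkℚᵘ; *≡*)
import Data.Rational.Unnormalised.Properties as ℚᵘP
import Data.Rational.Solver as ℚSolver
open import Data.List using (List)
open import Data.List.Relation.Binary.Permutation.Propositional using (↭-refl; ↭-trans; prep; swap)
open import Data.Product using (_,_)
open import Data.Sum using (inj₁; inj₂)
open import Relation.Binary.PropositionalEquality

toℚ-mkℚ : ∀ n → toℚ n ≡ mkℚ (+ n) 0 (Coprime.sym (Coprime.1-coprimeTo n))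
toℚ-mkℚ n = normalize-coprime (Coprime.sym (Coprime.1-coprimeTo n))

toℚᵘ-toℚ : ∀ n → toℚᵘ (toℚ n) ≡ mkℚᵘ (+ n) 0
toℚᵘ-toℚ n = cong toℚᵘ (toℚ-mkℚ n)

toℚ-injective : ∀ {m n} → toℚ m ≡ toℚ n → m ≡ n
toℚ-injective {m} {n} eq =
  ℤP.+-injective (cong ℚ.numerator (trans (sym (toℚ-mkℚ m)) (trans eq (toℚ-mkℚ n))))

toℚ-pos : ∀ {n} → 0 ℕ.< n → Positive (toℚ n)
toℚ-pos {n} 0<n = normalize-pos n 1 {{_}} {{ℕ.>-nonZero 0<n}}

toℚ-homo : ∀ (_∙_ : ℕ → ℕ → ℕ) (_◦_ : ℚ → ℚ → ℚ) (_◦ᵘ_ : ℚᵘ → ℚᵘ → ℚᵘ) →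
           (∀ p q → toℚᵘ (p ◦ q) ℚᵘ.≃ toℚᵘ p ◦ᵘ toℚᵘ q) →
           (∀ m n → mkℚᵘ (+ (m ∙ n)) 0 ℚᵘ.≃ mkℚᵘ (+ m) 0 ◦ᵘ mkℚᵘ (+ n) 0) →
           ∀ m n → toℚ (m ∙ n) ≡ toℚ m ◦ toℚ n
toℚ-homo _∙_ _◦_ _◦ᵘ_ toℚᵘ-homo fromℕ-homo m n = toℚᵘ-injective (begin
  toℚᵘ (toℚ (m ∙ n))             ≡⟨ toℚᵘ-toℚ (m ∙ n) ⟩
  mkℚᵘ (+ (m ∙ n)) 0             ≈⟨ fromℕ-homo m n ⟩
  mkℚᵘ (+ m) 0 ◦ᵘ mkℚᵘ (+ n) 0   ≡⟨ cong₂ _◦ᵘ_ (toℚᵘ-toℚ m) (toℚᵘ-toℚ n) ⟨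
  toℚᵘ (toℚ m) ◦ᵘ toℚᵘ (toℚ n)   ≈⟨ toℚᵘ-homo (toℚ m) (toℚ n) ⟨
  toℚᵘ (toℚ m ◦ toℚ n)           ∎)
  where open ℚᵘP.≃-Reasoning

toℚ-homo-+ : ∀ m n → toℚ (m + n) ≡ toℚ m ℚ.+ toℚ n
toℚ-homo-+ = toℚ-homo _+_ ℚ._+_ ℚᵘ._+_ toℚᵘ-homo-+ λ m n →
  *≡* (cong (ℤ._* ℤ.1ℤ) (trans (ℤP.pos-+ m n)
    (sym (cong₂ ℤ._+_ (ℤP.*-identityʳ (+ m)) (ℤP.*-identityʳ (+ n))))))

toℚ-homo-* : ∀ m n → toℚ (m ℕ.* n) ≡ toℚ m * toℚ n
toℚ-homo-* = toℚ-homo ℕ._*_ _*_ ℚᵘ._*_ toℚᵘ-homo-* λ m n →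
  *≡* (cong (ℤ._* ℤ.1ℤ) (ℤP.pos-* m n))

toℚ-homo-*⁴ : ∀ a b c d → toℚ (a ℕ.* b ℕ.* c ℕ.* d) ≡ toℚ a * toℚ b * toℚ c * toℚ d
toℚ-homo-*⁴ a b c d = trans (toℚ-homo-* (a ℕ.* b ℕ.* c) d)
  (cong (_* toℚ d) (trans (toℚ-homo-* (a ℕ.* b) c) (cong (_* toℚ c) (toℚ-homo-* a b))))

heronProduct : ℕ → ℕ → ℕ → ℕ
heronProduct a b c = (a + b + c) ℕ.* (b + c ∸ a) ℕ.* (a + c ∸ b) ℕ.* (a + b ∸ c)

heronProduct-swap₁₂ : ∀ a b c → heronProduct a b c ≡ heronProduct b a c
heronProduct-swap₁₂ a b c rewrite ℕP.+-comm a b =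
  reorder (b + a + c) (b + c ∸ a) (a + c ∸ b) (b + a ∸ c)
  where
  reorder : ∀ s p q r → s ℕ.* p ℕ.* q ℕ.* r ≡ s ℕ.* q ℕ.* p ℕ.* r
  reorder s p q r = solve (s ∷ p ∷ q ∷ r ∷ [])

heronProduct-swap₂₃ : ∀ a b c → heronProduct a b c ≡ heronProduct a c b
heronProduct-swap₂₃ a b c rewrite ℕP.+-assoc a c b | ℕP.+-comm c b | sym (ℕP.+-assoc a b c) =
  reorder (a + b + c) (b + c ∸ a) (a + c ∸ b) (a + b ∸ c)
  where
  reorder : ∀ s p q r → s ℕ.* p ℕ.* q ℕ.* r ≡ s ℕ.* p ℕ.* r ℕ.* q
  reorder s p q r = solve (s ∷ p ∷ q ∷ r ∷ [])

heronProduct-isosceles : ∀ x c → c ℕ.≤ x + x →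
                         heronProduct x x c + c ℕ.* c ℕ.* c ℕ.* c ≡ 4 ℕ.* (x ℕ.* x) ℕ.* (c ℕ.* c)
heronProduct-isosceles x c c≤2x rewrite ℕP.m+n∸m≡n x c = begin
  (x + x + c) ℕ.* c ℕ.* c ℕ.* (x + x ∸ c) + c ℕ.* c ℕ.* c ℕ.* c
    ≡⟨ difference-of-squares (x + x) (x + x ∸ c) (sym (ℕP.m+[n∸m]≡n c≤2x)) ⟩
  (x + x) ℕ.* (x + x) ℕ.* (c ℕ.* c)
    ≡⟨ solve (x ∷ c ∷ []) ⟩
  4 ℕ.* (x ℕ.* x) ℕ.* (c ℕ.* c) ∎
  where
  open ≡-Reasoning
  difference-of-squares : ∀ s e → s ≡ c + e →
                          (s + c) ℕ.* c ℕ.* c ℕ.* e + c ℕ.* c ℕ.* c ℕ.* c ≡ s ℕ.* s ℕ.* (c ℕ.* c)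
  difference-of-squares .(c + e) e refl = solve (c ∷ e ∷ [])

isoscelesHeron-root : ∀ x c A → c ℕ.≤ x + x → 16 ℕ.* (A ℕ.* A) ≡ heronProduct x x c →
                      let D = 2 ℕ.* x ℕ.* c + 4 ℕ.* A in
                      c ℕ.* c ℕ.* c ℕ.* c + D ℕ.* D ≡ 4 ℕ.* x ℕ.* c ℕ.* D
isoscelesHeron-root x c A c≤2x heron = begin
  c ℕ.* c ℕ.* c ℕ.* c + (2 ℕ.* x ℕ.* c + 4 ℕ.* A) ℕ.* (2 ℕ.* x ℕ.* c + 4 ℕ.* A)
    ≡⟨ solve (x ∷ c ∷ A ∷ []) ⟩
  (16 ℕ.* (A ℕ.* A) + c ℕ.* c ℕ.* c ℕ.* c) + 4 ℕ.* (x ℕ.* x) ℕ.* (c ℕ.* c) + 16 ℕ.* x ℕ.* c ℕ.* A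
    ≡⟨ cong (λ t → t + 4 ℕ.* (x ℕ.* x) ℕ.* (c ℕ.* c) + 16 ℕ.* x ℕ.* c ℕ.* A) heron′ ⟩
  4 ℕ.* (x ℕ.* x) ℕ.* (c ℕ.* c) + 4 ℕ.* (x ℕ.* x) ℕ.* (c ℕ.* c) + 16 ℕ.* x ℕ.* c ℕ.* A
    ≡⟨ solve (x ∷ c ∷ A ∷ []) ⟩
  4 ℕ.* x ℕ.* c ℕ.* (2 ℕ.* x ℕ.* c + 4 ℕ.* A) ∎
  where
  open ≡-Reasoning
  heron′ : 16 ℕ.* (A ℕ.* A) + c ℕ.* c ℕ.* c ℕ.* c ≡ 4 ℕ.* (x ℕ.* x) ℕ.* (c ℕ.* c)
  heron′ = trans (cong (_+ c ℕ.* c ℕ.* c ℕ.* c) heron) (heronProduct-isosceles x c c≤2x)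

toℚ-isoscelesHeron-root : ∀ x c A → c ℕ.≤ x + x → 16 ℕ.* (A ℕ.* A) ≡ heronProduct x x c →
                          let D = toℚ (2 ℕ.* x ℕ.* c + 4 ℕ.* A) in
                          toℚ c * toℚ c * toℚ c * toℚ c ℚ.+ D * D ≡ toℚ 4 * toℚ x * toℚ c * D
toℚ-isoscelesHeron-root x c A c≤2x heron = begin
  toℚ c * toℚ c * toℚ c * toℚ c ℚ.+ toℚ D * toℚ D
    ≡⟨ cong₂ ℚ._+_ (toℚ-homo-*⁴ c c c c) (toℚ-homo-* D D) ⟨
  toℚ (c ℕ.* c ℕ.* c ℕ.* c) ℚ.+ toℚ (D ℕ.* D)
    ≡⟨ toℚ-homo-+ (c ℕ.* c ℕ.* c ℕ.* c) (D ℕ.* D) ⟨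
  toℚ (c ℕ.* c ℕ.* c ℕ.* c + D ℕ.* D)
    ≡⟨ cong toℚ (isoscelesHeron-root x c A c≤2x heron) ⟩
  toℚ (4 ℕ.* x ℕ.* c ℕ.* D)
    ≡⟨ toℚ-homo-*⁴ 4 x c D ⟩
  toℚ 4 * toℚ x * toℚ c * toℚ D ∎
  where
  open ≡-Reasoning
  D = 2 ℕ.* x ℕ.* c + 4 ℕ.* A

root⇒*-baseSide≡ : ∀ {x c k} → c * (k * k ℚ.+ 1ℚ) ≡ toℚ 4 * k * x → x * baseSide k ≡ c
root⇒*-baseSide≡ {x} {c} {k} root = begin
  x * baseSide k      ≡⟨ ℚ-solve 3 (λ x k w → x :* (con (toℚ 4) :* k :* w)
                                          := con (toℚ 4) :* k :* x :* w) refl x k w ⟩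
  toℚ 4 * k * x * w   ≡⟨ cong (_* w) root ⟨
  c * q * w           ≡⟨ *-assoc c q w ⟩
  c * (q * w)         ≡⟨ cong (c *_) (*-inverseʳ q) ⟩
  c * 1ℚ              ≡⟨ *-identityʳ c ⟩
  c                   ∎
  where
  open ≡-Reasoning
  open ℚSolver.+-*-Solver renaming (solve to ℚ-solve)
  q = k * k ℚ.+ 1ℚ
  instance _ = sq+1-nonZero k
  w = 1/ q

c²/D-isRoot : ∀ {x c D} .{{_ : NonZero D}} → c * c * c * c ℚ.+ D * D ≡ toℚ 4 * x * c * D →
              let k = c * c * 1/ D in c * (k * k ℚ.+ 1ℚ) ≡ toℚ 4 * k * x
c²/D-isRoot {x} {c} {D} root = begin
  c * (k * k ℚ.+ 1ℚ)
    ≡⟨ cong (λ t → c * (k * k ℚ.+ t)) (trans (cong₂ _*_ Du Du) (*-identityˡ 1ℚ)) ⟨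
  c * (k * k ℚ.+ D * u * (D * u))
    ≡⟨ ℚ-solve 3 (λ c D u → c :* (c :* c :* u :* (c :* c :* u) :+ D :* u :* (D :* u))
                         := c :* u :* u :* (c :* c :* c :* c :+ D :* D)) refl c D u ⟩
  c * u * u * (c * c * c * c ℚ.+ D * D)
    ≡⟨ cong (c * u * u *_) root ⟩
  c * u * u * (toℚ 4 * x * c * D)
    ≡⟨ ℚ-solve 4 (λ x c D u → c :* u :* u :* (con (toℚ 4) :* x :* c :* D)
                           := con (toℚ 4) :* (c :* c :* u) :* x :* (D :* u)) refl x c D u ⟩
  toℚ 4 * k * x * (D * u)
    ≡⟨ cong (toℚ 4 * k * x *_) Du ⟩
  toℚ 4 * k * x * 1ℚ
    ≡⟨ *-identityʳ (toℚ 4 * k * x) ⟩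
  toℚ 4 * k * x ∎
  where
  open ≡-Reasoning
  open ℚSolver.+-*-Solver renaming (solve to ℚ-solve)
  u = 1/ D
  k = c * c * u
  Du : D * u ≡ 1ℚ
  Du = *-inverseʳ D

baseSide-1 : baseSide 1ℚ ≡ toℚ 2
baseSide-1 = refl

*-baseSide-1⇒degenerate : ∀ x c → toℚ x * baseSide 1ℚ ≡ toℚ c → c ≡ x + x
*-baseSide-1⇒degenerate x c scaled = toℚ-injective (begin
  toℚ c                   ≡⟨ scaled ⟨
  toℚ x * baseSide 1ℚ     ≡⟨ cong (toℚ x *_) baseSide-1 ⟩
  toℚ x * toℚ 2           ≡⟨ toℚ-homo-* x 2 ⟨
  toℚ (x ℕ.* 2)           ≡⟨ cong toℚ {x ℕ.* 2} {x + x} (solve (x ∷ [])) ⟩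
  toℚ (x + x)             ∎)
  where open ≡-Reasoning

SimilarToModel : List ℚ → Set
SimilarToModel sides =
  Σ ℚ λ r → Σ ℚ λ k → 0ℚ < r × 0ℚ < k × k ≢ 1ℚ × sides ↭ (r ∷ r ∷ r * baseSide k ∷ [])

SimilarToModel-↭ : ∀ {xs ys} → xs ↭ ys → SimilarToModel ys → SimilarToModel xs
SimilarToModel-↭ xs↭ys (r , k , 0<r , 0<k , k≢1 , ys↭model) =
  r , k , 0<r , 0<k , k≢1 , ↭-trans xs↭ys ys↭model

*-baseSide⇒similar : ∀ {x c k} → 0ℚ < x → 0ℚ < k → k ≢ 1ℚ → x * baseSide k ≡ c →
                     SimilarToModel (x ∷ x ∷ c ∷ [])
*-baseSide⇒similar {x} 0<x 0<k k≢1 refl = x , _ , 0<x , 0<k , k≢1 , ↭-refl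

isoscelesHeron⇒similar : ∀ {x c} A → 0 ℕ.< x → 0 ℕ.< c → c ℕ.< x + x →
                         16 ℕ.* (A ℕ.* A) ≡ heronProduct x x c →
                         SimilarToModel (toℚ x ∷ toℚ x ∷ toℚ c ∷ [])
isoscelesHeron⇒similar {x} {c} A 0<x 0<c c<2x heron =
  *-baseSide⇒similar (positive⁻¹ (toℚ x) {{toℚ-pos 0<x}}) 0<k k≢1 scaled
  where
  D = 2 ℕ.* x ℕ.* c + 4 ℕ.* A
  0<D : 0 ℕ.< D
  0<D = ℕP.<-≤-trans (ℕP.*-mono-< {0} {2 ℕ.* x} (ℕP.*-mono-< {0} {2} ℕ.z<s 0<x) 0<c)
                     (ℕP.m≤m+n (2 ℕ.* x ℕ.* c) (4 ℕ.* A))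
  instance
    c-pos : Positive (toℚ c)
    c-pos = toℚ-pos 0<c
    D-pos : Positive (toℚ D)
    D-pos = toℚ-pos 0<D
    D-nonZero : NonZero (toℚ D)
    D-nonZero = pos⇒nonZero (toℚ D)
  k = toℚ c * toℚ c * 1/ toℚ D
  0<k : 0ℚ < k
  0<k = positive⁻¹ k {{pos*pos⇒pos (toℚ c * toℚ c) {{pos*pos⇒pos (toℚ c) (toℚ c)}}
                                   (1/ toℚ D) {{1/pos⇒pos (toℚ D)}}}}
  scaled : toℚ x * baseSide k ≡ toℚ c
  scaled = root⇒*-baseSide≡ {toℚ x} {toℚ c} {k}
             (c²/D-isRoot {toℚ x} {toℚ c} {toℚ D} (toℚ-isoscelesHeron-root x c A (ℕP.<⇒≤ c<2x) heron))
  k≢1 : k ≢ 1ℚ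
  k≢1 k≡1 = ℕP.<-irrefl (*-baseSide-1⇒degenerate x c (subst (λ t → toℚ x * baseSide t ≡ toℚ c) k≡1 scaled))
                        c<2x

theorem1p5 : (a b c : ℕ) → IsHeron a b c → IsIsosceles a b c → TwoSquareSides a b c →
    Σ ℚ λ r → Σ ℚ λ k → 0ℚ < r × 0ℚ < k × k ≢ 1ℚ ×
      (toℚ a ∷ toℚ b ∷ toℚ c ∷ []) ↭ (r ∷ r ∷ r * baseSide k ∷ [])
theorem1p5 a .a c (0<a , _ , 0<c , _ , _ , c<2a , A , _ , heron) (inj₁ refl) _ =
  isoscelesHeron⇒similar A 0<a 0<c c<2a heron
theorem1p5 a b .b (0<a , 0<b , _ , a<2b , _ , _ , A , _ , heron) (inj₂ (inj₁ refl)) _ =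
  SimilarToModel-↭ (↭-trans (swap (toℚ a) (toℚ b) ↭-refl) (prep (toℚ b) (swap (toℚ a) (toℚ b) ↭-refl)))
    (isoscelesHeron⇒similar A 0<b 0<a a<2b
      (trans heron (trans (heronProduct-swap₁₂ a b b) (heronProduct-swap₂₃ b a b))))
theorem1p5 a b .a (0<a , 0<b , _ , _ , b<2a , _ , A , _ , heron) (inj₂ (inj₂ refl)) _ =
  SimilarToModel-↭ (prep (toℚ a) (swap (toℚ b) (toℚ a) ↭-refl))
    (isoscelesHeron⇒similar A 0<a 0<b b<2a (trans heron (heronProduct-swap₂₃ a b a)))
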